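{- Let $n\ge 2$ be even with $2$-adic valuation $\nu\ge 1$, and put $m_i=n/2^i$. Let $a\in\mathbb{F}_{2^{n}}^*$, $b\in\mathbb{F}_4^*$ and $\omega\in\mathbb{F}_{2^n}$. Write $a=\alpha\tilde a$ with $\alpha\in U_1$ and $\tilde a\in\mathbb{F}_{2^{m_1}}^*$. Let $\tilde\alpha\in U_1$ satisfy $\tilde\alpha^2=\alpha$, and let $\beta=\psi_{m_0}(\alpha)^{ -1}\in\mathbb{F}_4^*$. Then \[ W_{f_{a,b}}(\omega)=W_{f_{\tilde a,\beta b}}(\tilde\alpha\,\omega). \]
   Context: For $k\mid l$, $\mathrm{Tr}_k^l:\mathbb{F}_{2^l}\to\mathbb{F}_{2^k}$ denotes the relative trace $x\mapsto\sum_{j=0}^{l/k-1}x^{2^{kj}}$, and $\mathrm{Tr}_l=\mathrm{Tr}_1^l$ is the absolute trace. $\chi(x)=(-1)^x$ for $x\in\mathbb{F}_2$, viewed as an integer $\pm1$. $m_0=n$, $m_1=n/2$. $U_1\subset\mathbb{F}_{2^n}^*$ is the group of $(2^{m_1}+1)$-th roots of unity; every element of $\mathbb{F}_{2^n}^*$ is uniquely a product of an element of $U_1$ and an element of $\mathbb{F}_{2^{m_1}}^*$. $\psi_{m_0}(x)=x^{(2^{m_0}-1)/3}$ (an element of $\mathbb{F}_4$). For $a\in\mathbb{F}_{2^n}^*$ and $b\in\mathbb{F}_4^*$, $f_{a,b}:\mathbb{F}_{2^n}\to\mathbb{F}_2$ is $f_{a,b}(x)=\mathrm{Tr}_{n}(a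 x^{2^{m_1}-1})+\mathrm{Tr}_2(b\,\psi_{m_0}(x))$. The Walsh transform of a Boolean function $f$ on $\mathbb{F}_{2^n}$ is $W_f(\omega)=\sum_{x\in\mathbb{F}_{2^n}}\chi(f(x)+\mathrm{Tr}_n(\omega x))$. -}

module Defs where

open import Level using (0ℓ)
open import Data.Nat using (ℕ; zero; suc; _∸_; _/_) renaming (_^_ to _^ℕ_; _+_ to _+ℕ_)
open import Data.Integer using (ℤ; +_) renaming (_+_ to _+ℤ_; -_ to negℤ)
open import Data.List using (List; []; _∷_; length)
open import Data.List.Relation.Unary.Unique.Propositional using (Unique)
open import Data.List.Membership.Propositional using (_∈_)
open import Data.Product using (Σ; _×_)
open import Relation.Nullary using (¬_; yes; no)
open import Relation.Binary.Definitions using (DecidableEquality)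
open import Relation.Binary.PropositionalEquality using (_≡_)
open import Algebra.Structures using (IsCommutativeRing)

-- A finite field with exactly 2^n elements (hence characteristic 2, and,
-- up to isomorphism, the field F_{2^n}).  Equality is propositional.
record GF2^ (n : ℕ) : Set₁ where
  infixl 6 _+_
  infixl 7 _*_
  field
    Carrier : Set
    _+_ _*_ : Carrier → Carrier → Carrier
    -_      : Carrier → Carrier
    0# 1#   : Carrier
    isCommutativeRing : IsCommutativeRing _≡_ _+_ _*_ -_ 0# 1#
    0≢1     : ¬ (0# ≡ 1#)
    inverse : ∀ x → ¬ (x ≡ 0#) → Σ Carrier (λ y → x * y ≡ 1#)
    _≟_     : DecidableEquality Carrier
    elements : List Carrier
    elements-unique   : Unique elements
    elements-complete : ∀ x → x ∈ elements
    elements-count    : length elements ≡ 2 ^ℕ n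

  _^_ : Carrier → ℕ → Carrier
  x ^ zero  = 1#
  x ^ suc k = x * (x ^ k)

  traceSum : ℕ → Carrier → Carrier
  traceSum zero    x = 0#
  traceSum (suc k) x = traceSum k x + (x ^ (2 ^ℕ k))

  Tr : Carrier → Carrier
  Tr = traceSum n

  Tr₂ : Carrier → Carrier
  Tr₂ = traceSum 2

  m₁ : ℕ
  m₁ = n / 2

  ψ : Carrier → Carrier
  ψ x = x ^ ((2 ^ℕ n ∸ 1) / 3)

  f : Carrier → Carrier → Carrier → Carrier
  f a b x = Tr (a * (x ^ (2 ^ℕ m₁ ∸ 1))) + Tr₂ (b * ψ x)

  χ : Carrier → ℤ
  χ v with v ≟ 0#
  ... | yes _ = + 1
  ... | no  _ = negℤ (+ 1)

  sumℤ : List Carrier → (Carrier → ℤ) → ℤ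
  sumℤ []       g = + 0
  sumℤ (x ∷ xs) g = g x +ℤ sumℤ xs g

  W : (Carrier → Carrier) → Carrier → ℤ
  W g ω = sumℤ elements (λ x → χ (g x + Tr (ω * x)))

  InSubfield-m₁ : Carrier → Set
  InSubfield-m₁ x = x ^ (2 ^ℕ m₁) ≡ x
  InU₁ : Carrier → Set
  InU₁ x = x ^ (2 ^ℕ m₁ +ℕ 1) ≡ 1#
  InF₄ : Carrier → Set
  InF₄ x = x ^ 4 ≡ x

module Submission where

-- Write N = 2^{m₁}.  Substituting x = α̃ y in the Walsh
-- sum is a bijection of the field (α̃ ≠ 0), so it suffices to show the
-- pointwise identity  f_{a,b}(α̃ y) = f_{ã,βb}(y)  and
-- Tr(ω α̃ y) = Tr((α̃ ω) y).  The pointwise identity splits in two: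
--   * a α̃^{N-1} = ã α̃^{N+1} = ã, since a = α̃² ã and α̃ ∈ U₁;
--   * ψ(α̃) = β: ψ is multiplicative, so ψ(α) = ψ(α̃)², and ψ(α̃)³ = 1
--     because 3·(2ⁿ-1)/3 = 2ⁿ - 1 = (N+1)(N-1) when n is even; hence
--     β = ψ(α̃)^{-2} = ψ(α̃).

open import Defs
open import Data.Nat using (ℕ; _≤_)
open import Data.Nat.Divisibility using (_∣_)
open import Relation.Nullary using (¬_)
open import Relation.Binary.PropositionalEquality using (_≡_)

import Data.Nat as ℕ
open import Data.Nat using (zero; suc; _∸_; _/_)
import Data.Nat.Properties as ℕₚ
open import Data.Nat.DivMod using (m*n/n≡m; m/n*n≡m)
open import Data.Nat.Divisibility using (divides)
open import Data.Nat.Tactic.RingSolver using (solve-∀)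
open import Data.Integer using (ℤ; +_) renaming (_+_ to _+ℤ_)
open import Data.Integer.Properties using (+-0-commutativeMonoid)
open import Data.List using (List; []; _∷_; map; foldr)
open import Data.List.Properties using (map-∘; map-cong)
open import Data.List.Relation.Binary.Permutation.Propositional using (_↭_; ↭⇒↭ₛ)
import Data.List.Relation.Binary.Permutation.Propositional.Properties as ↭
open import Data.List.Relation.Binary.Permutation.Setoid.Properties using (foldr-commMonoid)
open import Data.List.Relation.Binary.BagAndSetEquality using (∼bag⇒↭)
open import Data.List.Membership.Propositional using (_∈_)
open import Data.List.Membership.Propositional.Properties using (∈-map⁺)
open import Data.List.Membership.Propositional.Properties.WithK using (unique∧set⇒bag)
import Data.List.Relation.Unary.Unique.Propositional.Properties as Unique
open import Data.Product using (∃-syntax; _,_)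
open import Function.Bundles using (mk⇔)
open import Level using (0ℓ)
open import Algebra.Bundles using (CommutativeRing; CommutativeMonoid)
open import Relation.Binary.PropositionalEquality
  using (refl; sym; trans; cong; cong₂; subst; module ≡-Reasoning)

four^q≡1-mod-3 : ∀ q → ∃[ t ] 2 ℕ.^ (q ℕ.* 2) ≡ suc (t ℕ.* 3)
four^q≡1-mod-3 zero = 0 , refl
four^q≡1-mod-3 (suc q) with four^q≡1-mod-3 q
... | t , e = 1 ℕ.+ 4 ℕ.* t , trans (cong (λ z → 2 ℕ.* (2 ℕ.* z)) e) (times-four t)
  where
  times-four : ∀ t → 2 ℕ.* (2 ℕ.* suc (t ℕ.* 3)) ≡ suc ((1 ℕ.+ 4 ℕ.* t) ℕ.* 3)
  times-four = solve-∀

-- Hence the exponent (2ⁿ - 1)/3 of ψ is an exact quotient for even n.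
3∣2^[2q]∸1 : ∀ q → 3 ∣ 2 ℕ.^ (q ℕ.* 2) ∸ 1
3∣2^[2q]∸1 q with four^q≡1-mod-3 q
... | t , e = divides t (cong (_∸ 1) e)

difference-of-squares : ∀ N → (N ℕ.+ 1) ℕ.* (N ∸ 1) ≡ N ℕ.* N ∸ 1
difference-of-squares zero    = refl
difference-of-squares (suc r) = expand r
  where
  expand : ∀ r → (suc r ℕ.+ 1) ℕ.* r ≡ r ℕ.+ r ℕ.* suc r
  expand = solve-∀

2^[2q]≡square : ∀ q → 2 ℕ.^ (q ℕ.* 2) ≡ 2 ℕ.^ q ℕ.* 2 ℕ.^ q
2^[2q]≡square q = trans (sym (ℕₚ.^-*-assoc 2 q 2))
                        (cong (2 ℕ.^ q ℕ.*_) (ℕₚ.*-identityʳ (2 ℕ.^ q)))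

ψ-exponent-factorises : ∀ q →
  (2 ℕ.^ (q ℕ.* 2) ∸ 1) / 3 ℕ.* 3 ≡ (2 ℕ.^ q ℕ.+ 1) ℕ.* (2 ℕ.^ q ∸ 1)
ψ-exponent-factorises q = begin
  (2 ℕ.^ (q ℕ.* 2) ∸ 1) / 3 ℕ.* 3   ≡⟨ m/n*n≡m (3∣2^[2q]∸1 q) ⟩
  2 ℕ.^ (q ℕ.* 2) ∸ 1               ≡⟨ cong (_∸ 1) (2^[2q]≡square q) ⟩
  2 ℕ.^ q ℕ.* 2 ℕ.^ q ∸ 1           ≡⟨ sym (difference-of-squares (2 ℕ.^ q)) ⟩
  (2 ℕ.^ q ℕ.+ 1) ℕ.* (2 ℕ.^ q ∸ 1) ∎
  where open ≡-Reasoning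

2+[N∸1]≡N+1 : ∀ {N} → 0 ℕ.< N → 2 ℕ.+ (N ∸ 1) ≡ N ℕ.+ 1
2+[N∸1]≡N+1 {suc r} _ = cong suc (ℕₚ.+-comm 1 r)

sumList : List ℤ → ℤ
sumList = foldr _+ℤ_ (+ 0)

sumList-↭ : ∀ {xs ys} → xs ↭ ys → sumList xs ≡ sumList ys
sumList-↭ p = foldr-commMonoid ℤ+.setoid ℤ+.isCommutativeMonoid (↭⇒↭ₛ p)
  where module ℤ+ = CommutativeMonoid +-0-commutativeMonoid

module FiniteField {n : ℕ} (F : GF2^ n) where
  open GF2^ F

  ring : CommutativeRing 0ℓ 0ℓ
  ring = record { isCommutativeRing = isCommutativeRing }

  open CommutativeRing ring
    using (*-assoc; *-comm; *-identityˡ; *-identityʳ; zeroˡ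
          ; commutativeSemiring; *-commutativeSemigroup)
  open import Algebra.Properties.CommutativeSemiring.Exp commutativeSemiring
    using (^-assocʳ; ^-distrib-*) renaming (_^_ to _^ˢ_)
  open import Algebra.Properties.CommutativeSemigroup *-commutativeSemigroup
    using (x∙yz≈y∙xz)
  open ≡-Reasoning

  ^≡^ˢ : ∀ x k → x ^ k ≡ x ^ˢ k
  ^≡^ˢ x zero    = refl
  ^≡^ˢ x (suc k) = cong (x *_) (^≡^ˢ x k)

  ^-* : ∀ x i j → x ^ (i ℕ.* j) ≡ (x ^ i) ^ j
  ^-* x i j rewrite ^≡^ˢ x (i ℕ.* j) | ^≡^ˢ x i | ^≡^ˢ (x ^ˢ i) j =
    sym (^-assocʳ x i j)

  ^-distrib : ∀ x y k → (x * y) ^ k ≡ x ^ k * y ^ k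
  ^-distrib x y k rewrite ^≡^ˢ (x * y) k | ^≡^ˢ x k | ^≡^ˢ y k =
    ^-distrib-* x y k

  1^k≡1 : ∀ k → 1# ^ k ≡ 1#
  1^k≡1 zero    = refl
  1^k≡1 (suc k) = trans (*-identityˡ _) (1^k≡1 k)

  root-of-unity-nonzero : ∀ x k → x ^ suc k ≡ 1# → ¬ x ≡ 0#
  root-of-unity-nonzero x k x^[1+k]≡1 x≡0 = 0≢1 (begin
    0#          ≡⟨ sym (zeroˡ (x ^ k)) ⟩
    0# * x ^ k  ≡⟨ cong (_* x ^ k) (sym x≡0) ⟩
    x ^ suc k   ≡⟨ x^[1+k]≡1 ⟩
    1#          ∎)

  U₁-nonzero : ∀ {u} → InU₁ u → ¬ u ≡ 0#
  U₁-nonzero {u} u∈U₁ = root-of-unity-nonzero u (2 ℕ.^ m₁)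
    (trans (cong (u ^_) (ℕₚ.+-comm 1 (2 ℕ.^ m₁))) u∈U₁)

  bijection-permutes : (h h⁻¹ : Carrier → Carrier) →
    (∀ x → h (h⁻¹ x) ≡ x) → (∀ x → h⁻¹ (h x) ≡ x) → map h elements ↭ elements
  bijection-permutes h h⁻¹ right-inverse left-inverse =
    ∼bag⇒↭ (unique∧set⇒bag (Unique.map⁺ injective elements-unique) elements-unique
      (mk⇔ (λ _ → elements-complete _) (λ _ → covers _)))
    where
    injective : ∀ {x y} → h x ≡ h y → x ≡ y
    injective {x} {y} e =
      trans (sym (left-inverse x)) (trans (cong h⁻¹ e) (left-inverse y))
    covers : ∀ x → x ∈ map h elements
    covers x = subst (_∈ map h elements) (right-inverse x)
                     (∈-map⁺ h (elements-complete (h⁻¹ x)))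

  sumℤ≡sumList : ∀ xs g → sumℤ xs g ≡ sumList (map g xs)
  sumℤ≡sumList []       g = refl
  sumℤ≡sumList (x ∷ xs) g = cong (g x +ℤ_) (sumℤ≡sumList xs g)

  sum-rescale : ∀ {c} → ¬ c ≡ 0# → (g : Carrier → ℤ) →
    sumℤ elements (λ y → g (c * y)) ≡ sumℤ elements g
  sum-rescale {c} c≢0 g with inverse c c≢0
  ... | c⁻¹ , cc⁻¹≡1 = begin
    sumℤ elements (λ y → g (c * y))           ≡⟨ sumℤ≡sumList elements _ ⟩
    sumList (map (λ y → g (c * y)) elements)  ≡⟨ cong sumList (map-∘ elements) ⟩
    sumList (map g (map (c *_) elements))     ≡⟨ sumList-↭ (↭.map⁺ g permutes) ⟩
    sumList (map g elements)                  ≡⟨ sym (sumℤ≡sumList elements g) ⟩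
    sumℤ elements g                           ∎
    where
    cancel : ∀ u v x → u * v ≡ 1# → u * (v * x) ≡ x
    cancel u v x uv≡1 =
      trans (sym (*-assoc u v x)) (trans (cong (_* x) uv≡1) (*-identityˡ x))
    c⁻¹c≡1 : c⁻¹ * c ≡ 1#
    c⁻¹c≡1 = trans (*-comm c⁻¹ c) cc⁻¹≡1
    permutes : map (c *_) elements ↭ elements
    permutes = bijection-permutes (c *_) (c⁻¹ *_)
      (λ x → cancel c c⁻¹ x cc⁻¹≡1) (λ x → cancel c⁻¹ c x c⁻¹c≡1)

  W-rescale : ∀ {c g h ω} → ¬ c ≡ 0# → (∀ y → g (c * y) ≡ h y) →
    W g ω ≡ W h (c * ω)
  W-rescale {c} {g} {h} {ω} c≢0 g∘c≡h = begin
    W g ω                                            ≡⟨ sym (sum-rescale c≢0 summand) ⟩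
    sumℤ elements (λ y → summand (c * y))            ≡⟨ sumℤ≡sumList elements _ ⟩
    sumList (map (λ y → summand (c * y)) elements)   ≡⟨ cong sumList (map-cong rescaled elements) ⟩
    sumList (map (λ y → χ (h y + Tr ((c * ω) * y))) elements) ≡⟨ sym (sumℤ≡sumList elements _) ⟩
    W h (c * ω)                                      ∎
    where
    summand : Carrier → ℤ
    summand x = χ (g x + Tr (ω * x))
    rescaled : ∀ y → summand (c * y) ≡ χ (h y + Tr ((c * ω) * y))
    rescaled y = cong χ (cong₂ _+_ (g∘c≡h y)
      (cong Tr (trans (sym (*-assoc ω c y)) (cong (_* y) (*-comm ω c)))))

  ψ-* : ∀ x y → ψ (x * y) ≡ ψ x * ψ y
  ψ-* x y = ^-distrib x y ((2 ℕ.^ n ∸ 1) / 3)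

  cube-root-inverse-square : ∀ {p β} → p ^ 3 ≡ 1# → β * (p * p) ≡ 1# → p ≡ β
  cube-root-inverse-square {p} {β} p³≡1 βp²≡1 = begin
    p                      ≡⟨ sym (*-identityʳ p) ⟩
    p * 1#                 ≡⟨ cong (p *_) (sym βp²≡1) ⟩
    p * (β * (p * p))      ≡⟨ x∙yz≈y∙xz p β (p * p) ⟩
    β * (p * (p * p))      ≡⟨ cong (λ z → β * (p * (p * z))) (sym (*-identityʳ p)) ⟩
    β * p ^ 3              ≡⟨ cong (β *_) p³≡1 ⟩
    β * 1#                 ≡⟨ *-identityʳ β ⟩
    β                      ∎

  U₁-square-twist : ∀ {u} → InU₁ u → (u * u) * u ^ (2 ℕ.^ m₁ ∸ 1) ≡ 1#
  U₁-square-twist {u} u∈U₁ = begin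
    (u * u) * u ^ (2 ℕ.^ m₁ ∸ 1)   ≡⟨ *-assoc u u _ ⟩
    u ^ (2 ℕ.+ (2 ℕ.^ m₁ ∸ 1))     ≡⟨ cong (u ^_) (2+[N∸1]≡N+1 (ℕₚ.m^n>0 2 m₁)) ⟩
    u ^ (2 ℕ.^ m₁ ℕ.+ 1)           ≡⟨ u∈U₁ ⟩
    1#                             ∎

  coefficient-twist : ∀ {a α ã α̃} → a ≡ α * ã → α̃ * α̃ ≡ α → InU₁ α̃ →
    a * α̃ ^ (2 ℕ.^ m₁ ∸ 1) ≡ ã
  coefficient-twist {a} {α} {ã} {α̃} a≡αã α̃²≡α α̃∈U₁ = begin
    a * α̃ ^ K                  ≡⟨ cong (λ z → z * α̃ ^ K) (trans a≡αã (*-comm α ã)) ⟩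
    (ã * α) * α̃ ^ K            ≡⟨ *-assoc ã α _ ⟩
    ã * (α * α̃ ^ K)            ≡⟨ cong (λ z → ã * (z * α̃ ^ K)) (sym α̃²≡α) ⟩
    ã * ((α̃ * α̃) * α̃ ^ K)      ≡⟨ cong (ã *_) (U₁-square-twist α̃∈U₁) ⟩
    ã * 1#                     ≡⟨ *-identityʳ ã ⟩
    ã                          ∎
    where
    K : ℕ
    K = 2 ℕ.^ m₁ ∸ 1

  f-rescale : ∀ {a b c ã β} → a * c ^ (2 ℕ.^ m₁ ∸ 1) ≡ ã → ψ c ≡ β →
    ∀ y → f a b (c * y) ≡ f ã (β * b) y
  f-rescale {a} {b} {c} {ã} {β} twist ψc≡β y =
    cong₂ (λ u v → Tr u + Tr₂ v) first-term second-term
    where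
    K : ℕ
    K = 2 ℕ.^ m₁ ∸ 1
    first-term : a * (c * y) ^ K ≡ ã * y ^ K
    first-term = begin
      a * (c * y) ^ K        ≡⟨ cong (a *_) (^-distrib c y K) ⟩
      a * (c ^ K * y ^ K)    ≡⟨ sym (*-assoc a _ _) ⟩
      (a * c ^ K) * y ^ K    ≡⟨ cong (_* y ^ K) twist ⟩
      ã * y ^ K              ∎
    second-term : b * ψ (c * y) ≡ (β * b) * ψ y
    second-term = begin
      b * ψ (c * y)          ≡⟨ cong (b *_) (ψ-* c y) ⟩
      b * (ψ c * ψ y)        ≡⟨ cong (λ z → b * (z * ψ y)) ψc≡β ⟩
      b * (β * ψ y)          ≡⟨ sym (*-assoc b β _) ⟩
      (b * β) * ψ y          ≡⟨ cong (_* ψ y) (*-comm b β) ⟩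
      (β * b) * ψ y          ∎

module EvenDegree (q : ℕ) (F : GF2^ (q ℕ.* 2)) where
  open GF2^ F
  open FiniteField F
  open ≡-Reasoning

  m₁≡q : m₁ ≡ q
  m₁≡q = m*n/n≡m q 2

  -- ψ(u)³ = u^{2ⁿ-1} = (u^{N+1})^{N-1} = 1 for u ∈ U₁.
  ψ-cube-U₁ : ∀ {u} → InU₁ u → ψ u ^ 3 ≡ 1#
  ψ-cube-U₁ {u} u∈U₁ = begin
    ψ u ^ 3                        ≡⟨ sym (^-* u e 3) ⟩
    u ^ (e ℕ.* 3)                  ≡⟨ cong (u ^_) exponent ⟩
    u ^ ((N ℕ.+ 1) ℕ.* (N ∸ 1))    ≡⟨ ^-* u (N ℕ.+ 1) (N ∸ 1) ⟩
    (u ^ (N ℕ.+ 1)) ^ (N ∸ 1)      ≡⟨ cong (_^ (N ∸ 1)) u∈U₁ ⟩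
    1# ^ (N ∸ 1)                   ≡⟨ 1^k≡1 (N ∸ 1) ⟩
    1#                             ∎
    where
    e N : ℕ
    e = (2 ℕ.^ (q ℕ.* 2) ∸ 1) / 3
    N = 2 ℕ.^ m₁
    exponent : e ℕ.* 3 ≡ (N ℕ.+ 1) ℕ.* (N ∸ 1)
    exponent = trans (ψ-exponent-factorises q)
      (cong (λ m → (2 ℕ.^ m ℕ.+ 1) ℕ.* (2 ℕ.^ m ∸ 1)) (sym m₁≡q))

  ψ-square-root : ∀ {α α̃ β} → InU₁ α̃ → α̃ * α̃ ≡ α → β * ψ α ≡ 1# → ψ α̃ ≡ β
  ψ-square-root {α} {α̃} {β} α̃∈U₁ α̃²≡α βψα≡1 =
    cube-root-inverse-square (ψ-cube-U₁ α̃∈U₁)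
      (trans (cong (β *_) (sym (trans (cong ψ (sym α̃²≡α)) (ψ-* α̃ α̃)))) βψα≡1)

mainTheorem1 : (n : ℕ) → 2 ≤ n → 2 ∣ n → (F : GF2^ n) →
    let open GF2^ F in
    (a b ω α ã α̃ β : Carrier) →
    ¬ (a ≡ 0#) →
    InF₄ b → ¬ (b ≡ 0#) →
    InU₁ α → InSubfield-m₁ ã → ¬ (ã ≡ 0#) → a ≡ α * ã →
    InU₁ α̃ → α̃ * α̃ ≡ α →
    β * ψ α ≡ 1# →
    W (f a b) ω ≡ W (f ã (β * b)) (α̃ * ω)
mainTheorem1 n _ (divides q refl) F a b ω α ã α̃ β _ _ _ _ _ _
             a≡αã α̃∈U₁ α̃²≡α βψα≡1 =
  W-rescale (U₁-nonzero α̃∈U₁)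
    (f-rescale (coefficient-twist a≡αã α̃²≡α α̃∈U₁)
               (ψ-square-root α̃∈U₁ α̃²≡α βψα≡1))
  where
  open FiniteField F
  open EvenDegree q F
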